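{- Let $G$ be a finite graph that is vertex-transitive, twin-free, and has co-twins. Then $G$ is triangle-free if and only if $G$ is isomorphic to the crown graph on $2k$ vertices (the complete bipartite graph $K_{k,k}$ with a perfect matching removed) for some $k\ge3$.
   Context: $N(u)$ is the open and $N[u]=N(u)\cup\{u\}$ the closed neighborhood of $u$. A graph is twin-free if no two distinct vertices have equal open neighborhoods and no two distinct vertices have equal closed neighborhoods. Co-twins means nonadjacent co-twins: distinct vertices $u,v$ with $N[u]\cap N[v]=\emptyset$ and $N[u]\cup N[v]=V(G)$. -}

module Defs where

open import Data.Nat using (ℕ)
open import Data.Fin using (Fin)
open import Data.Bool using (Bool; true; false)
open import Data.Product using (Σ; _×_; _,_; ∃; ∃-syntax)
open import Data.Sum using (_⊎_)
open import Relation.Binary.PropositionalEquality using (_≡_; _≢_)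
open import Relation.Nullary using (¬_)
open import Function.Bundles using (_↔_; Inverse)

record Graph (V : Set) : Set where
  field
    adj     : V → V → Bool
    adj-sym    : ∀ u v → adj u v ≡ adj v u
    adj-irrefl : ∀ v → adj v v ≡ false

open Graph public

Adj : {V : Set} → Graph V → V → V → Set
Adj G u v = adj G u v ≡ true

InN : {V : Set} → Graph V → V → V → Set
InN G u w = Adj G u w

InN[] : {V : Set} → Graph V → V → V → Set
InN[] G u w = (w ≡ u) ⊎ Adj G u w

-- Isomorphism between graphs: a bijection preserving adjacency (both directions,
-- since adj is Bool-valued and equality of Bools is required).
Iso : {V W : Set} → Graph V → Graph W → Set
Iso {V} {W} G H =
  Σ (V ↔ W) λ f → ∀ u v → adj H (Inverse.to f u) (Inverse.to f v) ≡ adj G u v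

Aut : {V : Set} → Graph V → Set
Aut G = Iso G G

VertexTransitive : {V : Set} → Graph V → Set
VertexTransitive G = ∀ u v → Σ (Aut G) λ φ → Inverse.to (Data.Product.proj₁ φ) u ≡ v
  where import Data.Product

NeighSetEq : {V : Set} → (V → Set) → (V → Set) → Set
NeighSetEq {V} A B = ∀ w → (A w → B w) × (B w → A w)

TwinFree : {V : Set} → Graph V → Set
TwinFree G = ∀ u v → u ≢ v →
  ¬ NeighSetEq (InN G u) (InN G v) × ¬ NeighSetEq (InN[] G u) (InN[] G v)

HasCoTwins : {V : Set} → Graph V → Set
HasCoTwins {V} G = Σ V λ u → Σ V λ v → u ≢ v
  × (∀ w → ¬ (InN[] G u w × InN[] G v w))
  × (∀ w → InN[] G u w ⊎ InN[] G v w)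

TriangleFree : {V : Set} → Graph V → Set
TriangleFree {V} G = ∀ a b c → ¬ (Adj G a b × Adj G b c × Adj G a c)

-- Crown graph on 2k vertices: vertices (i , s) with i : Fin k, s : Bool (side);
-- (i , s) ~ (j , t) iff s ≠ t and i ≠ j, i.e. K_{k,k} minus the perfect
-- matching {(i,false),(i,true)}.
open import Data.Bool using (_∧_; not; _xor_)
open import Data.Fin using (_≟_)
open import Relation.Nullary.Decidable using (⌊_⌋)

crownAdj : (k : ℕ) → Fin k × Bool → Fin k × Bool → Bool
crownAdj k (i , s) (j , t) = (s xor t) ∧ not ⌊ i ≟ j ⌋


crown : (k : ℕ) → Graph (Fin k × Bool)
crown k = record { adj = crownAdj k ; adj-sym = symP ; adj-irrefl = irr }
  where
  open import Relation.Binary.PropositionalEquality using (refl; cong₂; sym)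
  xc : ∀ s t → s xor t ≡ t xor s
  xc false false = refl
  xc false true = refl
  xc true false = refl
  xc true true = refl
  dc : ∀ (i j : Fin k) → ⌊ i ≟ j ⌋ ≡ ⌊ j ≟ i ⌋
  dc i j with i ≟ j | j ≟ i
  ... | Relation.Nullary.yes _ | Relation.Nullary.yes _ = refl
  ... | Relation.Nullary.no _ | Relation.Nullary.no _ = refl
  ... | Relation.Nullary.yes p | Relation.Nullary.no q = Data.Empty.⊥-elim (q (sym p))
    where import Data.Empty
  ... | Relation.Nullary.no q | Relation.Nullary.yes p = Data.Empty.⊥-elim (q (sym p))
    where import Data.Empty
  symP : ∀ u v → crownAdj k u v ≡ crownAdj k v u
  symP (i , s) (j , t) = cong₂ _∧_ (xc s t) (Relation.Binary.PropositionalEquality.cong not (dc i j))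
  irr : ∀ v → crownAdj k v v ≡ false
  irr (i , false) = refl
  irr (i , true) = refl

{-# OPTIONS --safe #-}
module Submission where

-- Vertex-transitivity carries the given co-twin pair to every vertex, and in a
-- twin-free graph co-twins are unique, so x ↦ x̄ (the co-twin of x) is an involution.
-- For co-twins u, ū the sets A = {u} ∪ N(ū) and B = {ū} ∪ N(u) partition V. If G is
-- triangle-free, both are independent, the involution swaps them, and x ∈ A is adjacent
-- to every y ∈ B except x̄. Enumerating A as a₀, …, a_{k-1} therefore identifies G with
-- the crown on 2k vertices via aᵢ ↦ (i, true), āᵢ ↦ (i, false). Twin-freeness rules out
-- k = 1 and k = 2. Conversely, crowns are bipartite, hence triangle-free.

open import Defs
open import Axiom.UniquenessOfIdentityProofs using (module Decidable⇒UIP)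
open import Data.Bool using (Bool; true; false; not)
import Data.Bool.Properties as Bool
open import Data.Empty using (⊥-elim)
open import Data.Fin using (Fin; zero; suc; _≟_)
open import Data.List using (List; _∷_; filter; allFin; lookup; length)
import Data.List.Relation.Unary.Any as Any
open import Data.List.Relation.Unary.Any.Properties using (lookup-index)
open import Data.List.Membership.Propositional.Properties
  using (∈-filter⁺; ∈-filter⁻; ∈-allFin; ∈-lookup)
open import Data.List.Membership.Setoid.Properties using (unique⇒irrelevant)
open import Data.List.Relation.Unary.Unique.Propositional.Properties using (filter⁺; allFin⁺)
open import Data.Nat as ℕ using (ℕ; _≥_; s≤s; z≤n)
open import Data.Product using (Σ; _×_; _,_; proj₁; proj₂)
import Data.Product as Product
open import Data.Sum using (_⊎_; inj₁; inj₂)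
import Data.Sum as Sum
open import Function using (_∘_; id; const)
open import Function.Bundles using (_⇔_; _↔_; Inverse; Injection; mk⇔; mk↔ₛ′)
open import Function.Properties.Inverse using (Inverse⇒Injection)
open import Level using (Level)
open import Relation.Binary.Definitions using (DecidableEquality)
open import Relation.Binary.PropositionalEquality
open import Relation.Nullary using (¬_; yes; no)
open import Relation.Nullary.Decidable using (⌊_⌋; _⊎-dec_)
open import Relation.Unary using (Pred; Decidable)

private
  variable
    V W : Set
    G : Graph V
    H : Graph W
    a b u v w x x′ y : V

index-∈-lookup : ∀ {ℓ} {A : Set ℓ} (xs : List A) i → Any.index (∈-lookup {xs = xs} i) ≡ i
index-∈-lookup (x ∷ xs) zero    = refl
index-∈-lookup (x ∷ xs) (suc i) = cong suc (index-∈-lookup xs i)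

module Enumeration {ℓ : Level} {n : ℕ} {P : Pred (Fin n) ℓ} (P? : Decidable P) where

  members : List (Fin n)
  members = filter P? (allFin n)

  size : ℕ
  size = length members

  enum : Fin size → Fin n
  enum = lookup members

  enum-satisfies : ∀ i → P (enum i)
  enum-satisfies i = proj₂ (∈-filter⁻ P? {xs = allFin n} (∈-lookup i))

  index : ∀ x → P x → Fin size
  index x px = Any.index (∈-filter⁺ P? (∈-allFin x) px)

  enum-index : ∀ x (px : P x) → enum (index x px) ≡ x
  enum-index x px = sym (lookup-index (∈-filter⁺ P? (∈-allFin x) px))

  index-enum : ∀ {i x} (px : P x) → enum i ≡ x → index x px ≡ i
  index-enum {i} px refl = begin
    Any.index (∈-filter⁺ P? (∈-allFin (enum i)) px)
      ≡⟨ cong Any.index (unique⇒irrelevant (setoid (Fin n)) (Decidable⇒UIP.≡-irrelevant _≟_)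
                           (filter⁺ P? (allFin⁺ n)) _ (∈-lookup i)) ⟩
    Any.index (∈-lookup {xs = members} i)
      ≡⟨ index-∈-lookup members i ⟩
    i ∎
    where open ≡-Reasoning

  enum-injective : ∀ {i j} → enum i ≡ enum j → i ≡ j
  enum-injective {i} {j} eq =
    trans (sym (index-enum (enum-satisfies j) eq)) (index-enum (enum-satisfies j) refl)

CoTwins : Graph V → V → V → Set
CoTwins G u v =
  u ≢ v × (∀ w → ¬ (InN[] G u w × InN[] G v w)) × (∀ w → InN[] G u w ⊎ InN[] G v w)

Side : Graph V → V → V → V → Set
Side G a b x = x ≡ a ⊎ Adj G b x

Side? : DecidableEquality V → (G : Graph V) → ∀ a b → Decidable (Side G a b)
Side? _≟_ G a b x = (x ≟ a) ⊎-dec (adj G b x Bool.≟ true)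

module GraphProperties (G : Graph V) where

  Adj-sym : Adj G u v → Adj G v u
  Adj-sym {u} {v} uv = trans (adj-sym G v u) uv

  ¬Adj-refl : ¬ Adj G v v
  ¬Adj-refl {v} vv with trans (sym (adj-irrefl G v)) vv
  ... | ()

  CoTwins-sym : CoTwins G u v → CoTwins G v u
  CoTwins-sym (u≢v , disjoint , cover) =
    u≢v ∘ sym , (λ w → disjoint w ∘ Product.swap) , (λ w → Sum.swap (cover w))

  CoTwins⇒¬Adj : CoTwins G u v → ¬ Adj G u v
  CoTwins⇒¬Adj (_ , disjoint , _) uv = disjoint _ (inj₂ uv , inj₁ refl)

  module _ (ab : CoTwins G a b) where

    private
      a≢b = proj₁ ab
      disjoint = proj₁ (proj₂ ab)
      cover = proj₂ (proj₂ ab)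

    Side-cover : ∀ x → Side G a b x ⊎ Side G b a x
    Side-cover x with cover x
    ... | inj₁ (inj₁ x≡a) = inj₁ (inj₁ x≡a)
    ... | inj₁ (inj₂ ax)  = inj₂ (inj₂ ax)
    ... | inj₂ (inj₁ x≡b) = inj₂ (inj₁ x≡b)
    ... | inj₂ (inj₂ bx)  = inj₁ (inj₂ bx)

    Side-disjoint : Side G a b x → ¬ Side G b a x
    Side-disjoint (inj₁ refl) (inj₁ refl) = a≢b refl
    Side-disjoint (inj₁ refl) (inj₂ aa)   = ¬Adj-refl aa
    Side-disjoint (inj₂ bb)   (inj₁ refl) = ¬Adj-refl bb
    Side-disjoint (inj₂ bx)   (inj₂ ax)   = disjoint _ (inj₂ ax , inj₂ bx)

    Side-independent : TriangleFree G → Side G a b x → Side G a b y → ¬ Adj G x y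
    Side-independent tri (inj₁ refl) (inj₁ refl) aa = ¬Adj-refl aa
    Side-independent tri (inj₁ refl) (inj₂ by)   ay = disjoint _ (inj₂ ay , inj₂ by)
    Side-independent tri (inj₂ bx)   (inj₁ refl) xa = disjoint _ (inj₂ (Adj-sym xa) , inj₂ bx)
    Side-independent tri (inj₂ bx)   (inj₂ by)   xy = tri _ _ _ (bx , xy , by)

    Side-closedNbr : TriangleFree G → Side G a b x → InN[] G x a → x ≡ a
    Side-closedNbr tri ax (inj₁ a≡x) = sym a≡x
    Side-closedNbr tri ax (inj₂ xa)  = ⊥-elim (Side-independent tri ax (inj₁ refl) xa)

module TwinFreeProperties (_≟_ : DecidableEquality V) (G : Graph V) (tf : TwinFree G) where

  open GraphProperties G

  -- Two co-twins of u both have closed neighbourhood V ∖ N[u].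
  CoTwins-unique : CoTwins G u v → CoTwins G u w → v ≡ w
  CoTwins-unique {u} {v} {w} (_ , disjoint₁ , cover₁) (_ , disjoint₂ , cover₂) with v ≟ w
  ... | yes v≡w = v≡w
  ... | no v≢w  = ⊥-elim (proj₂ (tf v w v≢w) λ z →
                    complement cover₂ disjoint₁ z , complement cover₁ disjoint₂ z)
    where
    complement : ∀ {v w} → (∀ z → InN[] G u z ⊎ InN[] G w z) →
                 (∀ z → ¬ (InN[] G u z × InN[] G v z)) →
                 ∀ z → InN[] G v z → InN[] G w z
    complement cover disjoint z vz =
      Sum.[ (λ uz → ⊥-elim (disjoint z (uz , vz))) , id ] (cover z)

  module _ (tri : TriangleFree G) where

    -- a lies in N[x] ∪ N[y]; on the independent side of a this forces x = a (hence y = b),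
    -- or, if y were on that side too, y = a (hence x = b).
    CoTwins-cross : CoTwins G a b → CoTwins G x y → Side G a b x → Side G b a y
    CoTwins-cross {a} {b} {x} {y} ab xy ax with proj₂ (proj₂ xy) a
    ... | inj₁ a∈N[x] =
      inj₁ (CoTwins-unique (subst (λ z → CoTwins G z y) x≡a xy) ab)
      where
      x≡a : x ≡ a
      x≡a = Side-closedNbr ab tri ax a∈N[x]
    ... | inj₂ a∈N[y] with Side-cover ab y
    ...   | inj₂ by = by
    ...   | inj₁ ay = ⊥-elim (Side-disjoint ab ax (inj₁ x≡b))
      where
      x≡b : x ≡ b
      x≡b = CoTwins-unique (subst (λ z → CoTwins G z x) y≡a (CoTwins-sym xy)) ab
        where
        y≡a : y ≡ a
        y≡a = Side-closedNbr ab tri ay a∈N[y]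

    Side-adj : CoTwins G a b → CoTwins G x x′ →
               Side G a b x → Side G b a y → y ≢ x′ → Adj G x y
    Side-adj {y = y} ab xx′ ax by y≢x′ with proj₂ (proj₂ xx′) y
    ... | inj₁ (inj₁ y≡x)  = ⊥-elim (Side-disjoint ab ax (subst (Side G _ _) y≡x by))
    ... | inj₁ (inj₂ xy)   = xy
    ... | inj₂ (inj₁ y≡x′) = ⊥-elim (y≢x′ y≡x′)
    ... | inj₂ (inj₂ x′y)  =
      ⊥-elim (Side-independent (CoTwins-sym ab) tri (CoTwins-cross ab xx′ ax) by x′y)

module IsoProperties {G : Graph V} {H : Graph W} (φ : Iso G H) where

  open Inverse (proj₁ φ) public using (to; from)
  open Inverse (proj₁ φ) using (strictlyInverseˡ)

  to-injective : to u ≡ to v → u ≡ v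
  to-injective = Injection.injective (Inverse⇒Injection (proj₁ φ))

  ∀-to : {Q : W → Set} → (∀ v → Q (to v)) → ∀ w → Q w
  ∀-to {Q} q w = subst Q (strictlyInverseˡ w) (q (from w))

  Adj-to : Adj G u v → Adj H (to u) (to v)
  Adj-to = trans (proj₂ φ _ _)

  Adj-to⁻ : Adj H (to u) (to v) → Adj G u v
  Adj-to⁻ = trans (sym (proj₂ φ _ _))

  InN[]-to : InN[] G u v → InN[] H (to u) (to v)
  InN[]-to = Sum.map (cong to) Adj-to

  InN[]-to⁻ : InN[] H (to u) (to v) → InN[] G u v
  InN[]-to⁻ = Sum.map to-injective Adj-to⁻

  TriangleFree-reflect : TriangleFree H → TriangleFree G
  TriangleFree-reflect triH a b c (ab , bc , ac) =
    triH (to a) (to b) (to c) (Adj-to ab , Adj-to bc , Adj-to ac)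

  private
    twins-reflect : {N : V → V → Set} {M : W → W → Set} →
                    (∀ {u v} → N u v → M (to u) (to v)) → (∀ {u v} → M (to u) (to v) → N u v) →
                    NeighSetEq (M (to u)) (M (to v)) → NeighSetEq (N u) (N v)
    twins-reflect f f⁻ twins w = f⁻ ∘ proj₁ (twins (to w)) ∘ f , f⁻ ∘ proj₂ (twins (to w)) ∘ f

  TwinFree-transport : TwinFree G → TwinFree H
  TwinFree-transport tf = ∀-to λ v → ∀-to λ v′ to-v≢to-v′ →
    let ¬open , ¬closed = tf v v′ (to-v≢to-v′ ∘ cong to)
    in ¬open ∘ twins-reflect {N = InN G} {M = InN H} Adj-to Adj-to⁻ ,
       ¬closed ∘ twins-reflect {N = InN[] G} {M = InN[] H} InN[]-to InN[]-to⁻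

  CoTwins-transport : CoTwins G u v → CoTwins H (to u) (to v)
  CoTwins-transport (u≢v , disjoint , cover) =
    u≢v ∘ to-injective ,
    ∀-to (λ w → disjoint w ∘ Product.map InN[]-to⁻ InN[]-to⁻) ,
    ∀-to (λ w → Sum.map InN[]-to InN[]-to (cover w))

Iso-fromLabelling : (f : V ↔ W) →
                    (∀ p q → adj G (Inverse.from f p) (Inverse.from f q) ≡ adj H p q) →
                    Iso G H
Iso-fromLabelling {G = G} {H = H} f label-adj = f , λ u v → begin
  adj H (to u) (to v)               ≡⟨ sym (label-adj (to u) (to v)) ⟩
  adj G (from (to u)) (from (to v)) ≡⟨ cong₂ (adj G) (strictlyInverseʳ u) (strictlyInverseʳ v) ⟩
  adj G u v                         ∎
  where
  open Inverse f
  open ≡-Reasoning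

crown-triangleFree : ∀ k → TriangleFree (crown k)
crown-triangleFree k (_ , false) (_ , false) _           (() , _ , _)
crown-triangleFree k (_ , true)  (_ , true)  _           (() , _ , _)
crown-triangleFree k (_ , false) (_ , true)  (_ , false) (_ , _ , ())
crown-triangleFree k (_ , false) (_ , true)  (_ , true)  (_ , () , _)
crown-triangleFree k (_ , true)  (_ , false) (_ , false) (_ , () , _)
crown-triangleFree k (_ , true)  (_ , false) (_ , true)  (_ , _ , ())

-- In crown 1 both vertices are isolated; in crown 2, which is two disjoint edges,
-- the ends of an edge are closed twins.
¬TwinFree-crown₁ : ¬ TwinFree (crown 1)
¬TwinFree-crown₁ tf = proj₁ (tf (zero , false) (zero , true) (λ ())) λ where
  (zero , false) → (λ ()) , (λ ())
  (zero , true)  → (λ ()) , (λ ())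

¬TwinFree-crown₂ : ¬ TwinFree (crown 2)
¬TwinFree-crown₂ tf = proj₂ (tf (zero , false) (suc zero , true) (λ ())) λ where
  (zero , false)     → const (inj₂ refl) , const (inj₁ refl)
  (suc zero , true)  → const (inj₁ refl) , const (inj₂ refl)
  (zero , true)      → (λ { (inj₁ ()) ; (inj₂ ()) }) , (λ { (inj₁ ()) ; (inj₂ ()) })
  (suc zero , false) → (λ { (inj₁ ()) ; (inj₂ ()) }) , (λ { (inj₁ ()) ; (inj₂ ()) })

TwinFree-crown⇒k≥3 : ∀ {k} → Fin k → TwinFree (crown k) → k ≥ 3
TwinFree-crown⇒k≥3 {0}                         () _
TwinFree-crown⇒k≥3 {1}                         _  tf = ⊥-elim (¬TwinFree-crown₁ tf)
TwinFree-crown⇒k≥3 {2}                         _  tf = ⊥-elim (¬TwinFree-crown₂ tf)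
TwinFree-crown⇒k≥3 {ℕ.suc (ℕ.suc (ℕ.suc _))} _  _  = s≤s (s≤s (s≤s z≤n))

module CoTwinMap (_≟_ : DecidableEquality V) (G : Graph V)
                 (vt : VertexTransitive G) (tf : TwinFree G) {u u′ : V} (uu′ : CoTwins G u u′) where

  open GraphProperties G
  open TwinFreeProperties _≟_ G tf

  private
    module Move (x : V) = IsoProperties {G = G} {H = G} (proj₁ (vt u x))

  coTwin : V → V
  coTwin x = Move.to x u′

  coTwin-spec : ∀ x → CoTwins G x (coTwin x)
  coTwin-spec x = subst (λ z → CoTwins G z (coTwin x)) (proj₂ (vt u x))
                        (Move.CoTwins-transport x uu′)

  coTwin-involutive : ∀ x → coTwin (coTwin x) ≡ x
  coTwin-involutive x = CoTwins-unique (coTwin-spec (coTwin x)) (CoTwins-sym (coTwin-spec x))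

  coTwin-injective : coTwin x ≡ coTwin y → x ≡ y
  coTwin-injective {x} {y} eq =
    trans (sym (coTwin-involutive x)) (trans (cong coTwin eq) (coTwin-involutive y))

module CrownLabelling {n : ℕ} (G : Graph (Fin n)) (vt : VertexTransitive G) (tf : TwinFree G)
                      (tri : TriangleFree G) {u u′ : Fin n} (uu′ : CoTwins G u u′) where

  open GraphProperties G
  open TwinFreeProperties _≟_ G tf
  open CoTwinMap _≟_ G vt tf uu′
  open Enumeration (Side? _≟_ G u u′)

  k : ℕ
  k = size

  coTwin-crosses : Side G u u′ x → Side G u′ u (coTwin x)
  coTwin-crosses ux = CoTwins-cross tri uu′ (coTwin-spec _) ux

  coTwin-crosses⁻ : ¬ Side G u u′ x → Side G u u′ (coTwin x)
  coTwin-crosses⁻ {x} ¬ux with Side-cover uu′ x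
  ... | inj₁ ux  = ⊥-elim (¬ux ux)
  ... | inj₂ u′x = CoTwins-cross tri (CoTwins-sym uu′) (coTwin-spec _) u′x

  label : Fin k × Bool → Fin n
  label (i , true)  = enum i
  label (i , false) = coTwin (enum i)

  unlabel : Fin n → Fin k × Bool
  unlabel x with Side? _≟_ G u u′ x
  ... | yes ux = index x ux , true
  ... | no ¬ux = index (coTwin x) (coTwin-crosses⁻ ¬ux) , false

  unlabel-label : ∀ p → unlabel (label p) ≡ p
  unlabel-label (i , true) with Side? _≟_ G u u′ (enum i)
  ... | yes ux = cong (_, true) (index-enum ux refl)
  ... | no ¬ux = ⊥-elim (¬ux (enum-satisfies i))
  unlabel-label (i , false) with Side? _≟_ G u u′ (coTwin (enum i))
  ... | yes ux = ⊥-elim (Side-disjoint uu′ ux (coTwin-crosses (enum-satisfies i)))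
  ... | no ¬ux = cong (_, false) (index-enum _ (sym (coTwin-involutive (enum i))))

  label-unlabel : ∀ x → label (unlabel x) ≡ x
  label-unlabel x with Side? _≟_ G u u′ x
  ... | yes ux = enum-index x ux
  ... | no ¬ux = trans (cong coTwin (enum-index _ _)) (coTwin-involutive x)

  label-adj-across : ∀ i j → adj G (enum i) (coTwin (enum j)) ≡ not ⌊ i ≟ j ⌋
  label-adj-across i j with i ≟ j
  ... | yes refl = Bool.¬-not (CoTwins⇒¬Adj (coTwin-spec (enum i)))
  ... | no i≢j   = Side-adj tri uu′ (coTwin-spec (enum i)) (enum-satisfies i)
                            (coTwin-crosses (enum-satisfies j))
                            (i≢j ∘ sym ∘ enum-injective ∘ coTwin-injective)

  label-adj : ∀ p q → adj G (label p) (label q) ≡ crownAdj k p q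
  label-adj (i , true)  (j , true)  =
    Bool.¬-not (Side-independent uu′ tri (enum-satisfies i) (enum-satisfies j))
  label-adj (i , false) (j , false) =
    Bool.¬-not (Side-independent (CoTwins-sym uu′) tri
                  (coTwin-crosses (enum-satisfies i)) (coTwin-crosses (enum-satisfies j)))
  label-adj (i , true)  (j , false) = label-adj-across i j
  label-adj (i , false) (j , true)  = begin
    adj G (coTwin (enum i)) (enum j)  ≡⟨ adj-sym G _ _ ⟩
    adj G (enum j) (coTwin (enum i))  ≡⟨ label-adj-across j i ⟩
    crownAdj k (j , true) (i , false) ≡⟨ adj-sym (crown k) (j , true) (i , false) ⟩
    crownAdj k (i , false) (j , true) ∎
    where open ≡-Reasoning

  iso : Iso G (crown k)
  iso = Iso-fromLabelling {G = G} {H = crown k}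
          (mk↔ₛ′ unlabel label unlabel-label label-unlabel) label-adj

proposition38 : (n : ℕ) (G : Graph (Fin n)) →
    VertexTransitive G → TwinFree G → HasCoTwins G →
    TriangleFree G ⇔ Σ ℕ (λ k → k ≥ 3 × Iso G (crown k))
proposition38 n G vt tf (u , u′ , uu′) = mk⇔ triangleFree⇒crown crown⇒triangleFree
  where
  triangleFree⇒crown : TriangleFree G → Σ ℕ (λ k → k ≥ 3 × Iso G (crown k))
  triangleFree⇒crown tri = k , TwinFree-crown⇒k≥3 (proj₁ (to u)) (TwinFree-transport tf) , iso
    where
    open CrownLabelling G vt tf tri uu′
    open IsoProperties {G = G} {H = crown k} iso

  crown⇒triangleFree : Σ ℕ (λ k → k ≥ 3 × Iso G (crown k)) → TriangleFree G
  crown⇒triangleFree (k , _ , φ) =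
    IsoProperties.TriangleFree-reflect {G = G} {H = crown k} φ (crown-triangleFree k)
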